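{- Let $F$ be a field of characteristic zero and let $1_\psi, 2_\psi, 3_\psi,\dots$ be nonzero elements of $F$. Fix $n\ge 1$ and, for $x\in F$, let $P_\psi[x]$ be the $n\times n$ matrix with rows and columns indexed by $i,j\in\{0,1,\dots,n-1\}$ and entries $\bigl(P_\psi[x]\bigr)_{i,j}=x^{i-j}\binom{i}{j}_\psi$ for $i\ge j$ and $0$ for $i<j$. Then for all $x,y\in F$, $$P_\psi[x]\,P_\psi[y]=P_\psi[x+_\psi y],$$ where $P_\psi[x+_\psi y]$ denotes the $n\times n$ matrix whose $(i,j)$ entry is $(x+_\psi y)^{i-j}\binom{i}{j}_\psi$ for $i\ge j$ and $0$ for $i<j$.
   Context: Notation: $0_\psi!=1$ and $m_\psi!=m_\psi\,(m-1)_\psi!$ for $m\ge1$. The $\psi$-binomial symbol is $\binom{m}{k}_\psi=\frac{m_\psi!}{k_\psi!\,(m-k)_\psi!}$ for $0\le k\le m$. For $x,y\in F$ and $m\ge 0$, the $\psi$-power of the $\psi$-sum is defined by $(x+_\psi y)^m=\sum_{k=0}^{m}\binom{m}{k}_\psi x^{k}y^{m-k}$ (with $0^0=1$). -}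

module Defs where

open import Level using (Level; _⊔_)
open import Data.Nat as ℕ using (ℕ; zero; suc; _∸_; _≤?_)
open import Data.Fin as Fin using (Fin; toℕ)
open import Relation.Nullary using (¬_; yes; no)
open import Algebra.Bundles using (CommutativeRing)

-- The inverse is given as a total
-- (≈-respecting) operation whose value at 0 is unconstrained.
record Field (c ℓ : Level) : Set (Level.suc (c ⊔ ℓ)) where
  field
    commutativeRing : CommutativeRing c ℓ
  open CommutativeRing commutativeRing public
  field
    _⁻¹      : Carrier → Carrier
    ⁻¹-cong  : ∀ {x y} → x ≈ y → x ⁻¹ ≈ y ⁻¹
    1≉0      : ¬ (1# ≈ 0#)
    inverseʳ : ∀ x → ¬ (x ≈ 0#) → x * (x ⁻¹) ≈ 1#

module _ {c ℓ : Level} (F : Field c ℓ) where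
  open Field F

  fromℕ : ℕ → Carrier
  fromℕ zero    = 0#
  fromℕ (suc m) = 1# + fromℕ m

  CharZero : Set ℓ
  CharZero = ∀ m → ¬ (fromℕ (suc m) ≈ 0#)

  -- x ^ m, with x ^ 0 = 1 (so 0 ^ 0 = 1)
  pow : Carrier → ℕ → Carrier
  pow x zero    = 1#
  pow x (suc m) = x * pow x m

  ΣFin : (n : ℕ) → (Fin n → Carrier) → Carrier
  ΣFin zero    f = 0#
  ΣFin (suc n) f = f Fin.zero + ΣFin n (λ k → f (Fin.suc k))

  -- ψ is the sequence m ↦ m_ψ (only the values at m ≥ 1 are used)
  module Psi (ψ : ℕ → Carrier) where

    fact : ℕ → Carrier
    fact zero    = 1#
    fact (suc m) = ψ (suc m) * fact m

    -- ψ-binomial  m_ψ! / (k_ψ! (m-k)_ψ!)   (meaningful for k ≤ m)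
    binom : ℕ → ℕ → Carrier
    binom m k = fact m * ((fact k * fact (m ∸ k)) ⁻¹)

    -- (x +_ψ y)^m = Σ_{k=0}^m binom m k · x^k · y^(m-k)
    psiSumPow : Carrier → Carrier → ℕ → Carrier
    psiSumPow x y m =
      ΣFin (suc m) (λ k → binom m (toℕ k) * (pow x (toℕ k) * pow y (m ∸ toℕ k)))

    Matrix : ℕ → Set c
    Matrix n = Fin n → Fin n → Carrier

    pascalWith : (n : ℕ) → (ℕ → Carrier) → Matrix n
    pascalWith n p i j with toℕ j ≤? toℕ i
    ... | yes _ = p (toℕ i ∸ toℕ j) * binom (toℕ i) (toℕ j)
    ... | no  _ = 0#

    P : (n : ℕ) → Carrier → Matrix n
    P n x = pascalWith n (pow x)

    Psum : (n : ℕ) → Carrier → Carrier → Matrix n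
    Psum n x y = pascalWith n (psiSumPow x y)

    matMul : (n : ℕ) → Matrix n → Matrix n → Matrix n
    matMul n A B i j = ΣFin n (λ k → A i k * B k j)

    _≈ᴹ_ : {n : ℕ} → Matrix n → Matrix n → Set ℓ
    A ≈ᴹ B = ∀ i j → A i j ≈ B i j

-- Row i of P[x] times column j of P[y] is Σ_{j ≤ k ≤ i} x^(i-k) (i k) y^(k-j) (k j), writing (m k) for
-- the ψ-binomial.  Since the ψ-factorials are invertible, (i k) (k j) = (i j) (i-j i-k), exactly as for
-- ordinary binomials, so with d = i - j and l = i - k the sum becomes (i j) Σ_{l ≤ d} (d l) x^l y^(d-l),
-- the (i, j) entry of P[x +_ψ y].  Nothing about powers is used: for any sequences p and q the
-- ψ-Pascal matrices built from p and q multiply to the one built from their ψ-binomial convolution.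
module Submission where

open import Algebra.Bundles using (Semiring)
open import Data.Empty using (⊥-elim)
open import Data.Fin as Fin using (Fin; toℕ)
open import Data.Fin.Properties using (toℕ<n)
open import Data.Nat as ℕ using (ℕ; zero; suc; _∸_; _≤_; _<_; _≤?_; z≤n; s≤s)
open import Data.Nat.Properties
  using (+-suc; +-∸-assoc; m+n∸m≡n; n∸n≡0; m≤m+n; m≤n⇒∃[o]m+o≡n;
         <⇒≱; ≤-<-connex; ≤-<-trans; ≤-pred; +-commutativeSemigroup)
open import Data.Product using (_,_)
open import Data.Sum as Sum using (_⊎_; inj₁; inj₂)
open import Level using (Level)
open import Relation.Nullary using (¬_; yes; no)
open import Relation.Binary.PropositionalEquality as ≡ using (_≡_)
open import Algebra.Properties.CommutativeSemigroup +-commutativeSemigroup using (x∙yz≈xz∙y)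

open import Defs

module ∑ℕ-Properties {c ℓ} (R : Semiring c ℓ) where
  open Semiring R
  open import Relation.Binary.Reasoning.Setoid setoid

  ∑ℕ : ℕ → (ℕ → Carrier) → Carrier
  ∑ℕ zero    g = 0#
  ∑ℕ (suc m) g = g 0 + ∑ℕ m (λ k → g (suc k))

  ∑ℕ-cong : ∀ m {g h : ℕ → Carrier} → (∀ k → k < m → g k ≈ h k) → ∑ℕ m g ≈ ∑ℕ m h
  ∑ℕ-cong zero    g≈h = refl
  ∑ℕ-cong (suc m) g≈h =
    +-cong (g≈h 0 (s≤s z≤n)) (∑ℕ-cong m (λ k k<m → g≈h (suc k) (s≤s k<m)))

  ∑ℕ-zero : ∀ m {g : ℕ → Carrier} → (∀ k → k < m → g k ≈ 0#) → ∑ℕ m g ≈ 0#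
  ∑ℕ-zero zero    g≈0 = refl
  ∑ℕ-zero (suc m) {g} g≈0 = begin
    g 0 + ∑ℕ m (λ k → g (suc k))
      ≈⟨ +-cong (g≈0 0 (s≤s z≤n)) (∑ℕ-zero m (λ k k<m → g≈0 (suc k) (s≤s k<m))) ⟩
    0# + 0#
      ≈⟨ +-identityˡ 0# ⟩
    0# ∎

  ∑ℕ-+ : ∀ a b (g : ℕ → Carrier) → ∑ℕ (a ℕ.+ b) g ≈ ∑ℕ a g + ∑ℕ b (λ k → g (a ℕ.+ k))
  ∑ℕ-+ zero    b g = sym (+-identityˡ _)
  ∑ℕ-+ (suc a) b g = trans (+-congˡ (∑ℕ-+ a b (λ k → g (suc k)))) (sym (+-assoc _ _ _))

  ∑ℕ-suc : ∀ m (g : ℕ → Carrier) → ∑ℕ (suc m) g ≈ ∑ℕ m g + g m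
  ∑ℕ-suc zero    g = trans (+-identityʳ _) (sym (+-identityˡ _))
  ∑ℕ-suc (suc m) g = trans (+-congˡ (∑ℕ-suc m (λ k → g (suc k)))) (sym (+-assoc _ _ _))

  ∑ℕ-reverse : ∀ m (g : ℕ → Carrier) → ∑ℕ (suc m) g ≈ ∑ℕ (suc m) (λ l → g (m ∸ l))
  ∑ℕ-reverse zero    g = refl
  ∑ℕ-reverse (suc m) g = begin
    g 0 + ∑ℕ (suc m) (λ k → g (suc k))
      ≈⟨ +-congˡ (∑ℕ-reverse m (λ k → g (suc k))) ⟩
    g 0 + ∑ℕ (suc m) (λ l → g (suc (m ∸ l)))
      ≈⟨ +-comm _ _ ⟩
    ∑ℕ (suc m) (λ l → g (suc (m ∸ l))) + g 0
      ≈⟨ +-cong (∑ℕ-cong (suc m) suc-∸) (reflexive (≡.cong g (n∸n≡0 m))) ⟨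
    ∑ℕ (suc m) (λ l → g (suc m ∸ l)) + g (suc m ∸ suc m)
      ≈⟨ ∑ℕ-suc (suc m) (λ l → g (suc m ∸ l)) ⟨
    ∑ℕ (suc (suc m)) (λ l → g (suc m ∸ l)) ∎
    where
    suc-∸ : ∀ l → l < suc m → g (suc m ∸ l) ≈ g (suc (m ∸ l))
    suc-∸ l l<1+m = reflexive (≡.cong g (+-∸-assoc 1 (≤-pred l<1+m)))

  *-distribˡ-∑ℕ : ∀ m a (g : ℕ → Carrier) → a * ∑ℕ m g ≈ ∑ℕ m (λ k → a * g k)
  *-distribˡ-∑ℕ zero    a g = zeroʳ a
  *-distribˡ-∑ℕ (suc m) a g =
    trans (distribˡ a _ _) (+-congˡ (*-distribˡ-∑ℕ m a (λ k → g (suc k))))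

  ∑ℕ-support : ∀ {n} a d {g : ℕ → Carrier} → a ℕ.+ d < n →
               (∀ k → k < a → g k ≈ 0#) → (∀ k → a ℕ.+ d < k → g k ≈ 0#) →
               ∑ℕ n g ≈ ∑ℕ (suc d) (λ t → g (a ℕ.+ t))
  ∑ℕ-support a d {g} a+d<n below above with m≤n⇒∃[o]m+o≡n a+d<n
  ... | e , ≡.refl = begin
    ∑ℕ (suc (a ℕ.+ d) ℕ.+ e) g
      ≈⟨ ∑ℕ-+ (suc (a ℕ.+ d)) e g ⟩
    ∑ℕ (suc (a ℕ.+ d)) g + ∑ℕ e (λ k → g (suc (a ℕ.+ d) ℕ.+ k))
      ≈⟨ +-congˡ (∑ℕ-zero e (λ k _ → above _ (s≤s (m≤m+n (a ℕ.+ d) k)))) ⟩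
    ∑ℕ (suc (a ℕ.+ d)) g + 0#
      ≈⟨ +-identityʳ _ ⟩
    ∑ℕ (suc (a ℕ.+ d)) g
      ≡⟨ ≡.cong (λ m → ∑ℕ m g) (+-suc a d) ⟨
    ∑ℕ (a ℕ.+ suc d) g
      ≈⟨ ∑ℕ-+ a (suc d) g ⟩
    ∑ℕ a g + ∑ℕ (suc d) (λ t → g (a ℕ.+ t))
      ≈⟨ +-congʳ (∑ℕ-zero a below) ⟩
    0# + ∑ℕ (suc d) (λ t → g (a ℕ.+ t))
      ≈⟨ +-identityˡ _ ⟩
    ∑ℕ (suc d) (λ t → g (a ℕ.+ t)) ∎

module FieldProperties {c ℓ} (F : Field c ℓ) where
  open Field F
  open import Relation.Binary.Reasoning.Setoid setoid

  x*y*y⁻¹≈x : ∀ x {y} → y ≉ 0# → x * y * y ⁻¹ ≈ x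
  x*y*y⁻¹≈x x {y} y≉0 = begin
    x * y * y ⁻¹   ≈⟨ *-assoc x y (y ⁻¹) ⟩
    x * (y * y ⁻¹) ≈⟨ *-congˡ (inverseʳ y y≉0) ⟩
    x * 1#         ≈⟨ *-identityʳ x ⟩
    x              ∎

  x*y⁻¹*y≈x : ∀ x {y} → y ≉ 0# → x * y ⁻¹ * y ≈ x
  x*y⁻¹*y≈x x {y} y≉0 = begin
    x * y ⁻¹ * y   ≈⟨ *-assoc x (y ⁻¹) y ⟩
    x * (y ⁻¹ * y) ≈⟨ *-congˡ (*-comm (y ⁻¹) y) ⟩
    x * (y * y ⁻¹) ≈⟨ *-assoc x y (y ⁻¹) ⟨
    x * y * y ⁻¹   ≈⟨ x*y*y⁻¹≈x x y≉0 ⟩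
    x              ∎

  *-≉0 : ∀ {x y} → x ≉ 0# → y ≉ 0# → x * y ≉ 0#
  *-≉0 {x} {y} x≉0 y≉0 xy≈0 = x≉0 (begin
    x            ≈⟨ x*y*y⁻¹≈x x y≉0 ⟨
    x * y * y ⁻¹ ≈⟨ *-congʳ xy≈0 ⟩
    0# * y ⁻¹    ≈⟨ zeroˡ (y ⁻¹) ⟩
    0#           ∎)

  *-cancelʳ-≈ : ∀ {x y z} → z ≉ 0# → x * z ≈ y * z → x ≈ y
  *-cancelʳ-≈ {x} {y} {z} z≉0 xz≈yz = begin
    x            ≈⟨ x*y*y⁻¹≈x x z≉0 ⟨
    x * z * z ⁻¹ ≈⟨ *-congʳ xz≈yz ⟩
    y * z * z ⁻¹ ≈⟨ x*y*y⁻¹≈x y z≉0 ⟩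
    y            ∎

module PsiPascal {c ℓ} (F : Field c ℓ) (ψ : ℕ → Field.Carrier F)
                 (ψ≉0 : ∀ m → Field._≉_ F (ψ (suc m)) (Field.0# F)) where
  open Field F
  open Psi F ψ
  open FieldProperties F
  open ∑ℕ-Properties semiring
  open import Algebra.Solver.CommutativeMonoid *-commutativeMonoid using (solve; _⊕_; _⊜_)
  open import Relation.Binary.Reasoning.Setoid setoid

  fact≉0 : ∀ m → fact m ≉ 0#
  fact≉0 zero    = 1≉0
  fact≉0 (suc m) = *-≉0 (ψ≉0 m) (fact≉0 m)

  binom*fact*fact≈fact : ∀ a b → binom (a ℕ.+ b) a * (fact a * fact b) ≈ fact (a ℕ.+ b)
  binom*fact*fact≈fact a b = begin
    fact (a ℕ.+ b) * (fact a * fact (a ℕ.+ b ∸ a)) ⁻¹ * (fact a * fact b)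
      ≡⟨ ≡.cong (λ r → fact (a ℕ.+ b) * (fact a * fact r) ⁻¹ * (fact a * fact b)) (m+n∸m≡n a b) ⟩
    fact (a ℕ.+ b) * (fact a * fact b) ⁻¹ * (fact a * fact b)
      ≈⟨ x*y⁻¹*y≈x _ (*-≉0 (fact≉0 a) (fact≉0 b)) ⟩
    fact (a ℕ.+ b) ∎

  -- The ψ-analogue of trinomial revision: both sides are fact i / (fact j · fact l · fact a),
  -- so they are compared after multiplying by that denominator.
  binom-trinomial : ∀ j l a → binom (j ℕ.+ (l ℕ.+ a)) (j ℕ.+ a) * binom (j ℕ.+ a) j
                              ≈ binom (j ℕ.+ (l ℕ.+ a)) j * binom (l ℕ.+ a) l
  binom-trinomial j l a =
    *-cancelʳ-≈ (*-≉0 (fact≉0 j) (*-≉0 (fact≉0 l) (fact≉0 a))) (trans lhs (sym rhs))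
    where
    k = j ℕ.+ a
    i = j ℕ.+ (l ℕ.+ a)
    lhs : binom i k * binom k j * (fact j * (fact l * fact a)) ≈ fact i
    lhs = begin
      binom i k * binom k j * (fact j * (fact l * fact a))
        ≈⟨ solve 5 (λ u v fj fl fa → (u ⊕ v) ⊕ (fj ⊕ (fl ⊕ fa)) ⊜ u ⊕ ((v ⊕ (fj ⊕ fa)) ⊕ fl))
                 refl (binom i k) (binom k j) (fact j) (fact l) (fact a) ⟩
      binom i k * (binom k j * (fact j * fact a) * fact l)
        ≈⟨ *-congˡ (*-congʳ (binom*fact*fact≈fact j a)) ⟩
      binom i k * (fact k * fact l)
        ≡⟨ ≡.cong (λ m → binom m k * (fact k * fact l)) (x∙yz≈xz∙y j l a) ⟩
      binom (k ℕ.+ l) k * (fact k * fact l)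
        ≈⟨ binom*fact*fact≈fact k l ⟩
      fact (k ℕ.+ l)
        ≡⟨ ≡.cong fact (x∙yz≈xz∙y j l a) ⟨
      fact i ∎
    rhs : binom i j * binom (l ℕ.+ a) l * (fact j * (fact l * fact a)) ≈ fact i
    rhs = begin
      binom i j * binom (l ℕ.+ a) l * (fact j * (fact l * fact a))
        ≈⟨ solve 5 (λ u v fj fl fa → (u ⊕ v) ⊕ (fj ⊕ (fl ⊕ fa)) ⊜ u ⊕ (fj ⊕ (v ⊕ (fl ⊕ fa))))
                 refl (binom i j) (binom (l ℕ.+ a) l) (fact j) (fact l) (fact a) ⟩
      binom i j * (fact j * (binom (l ℕ.+ a) l * (fact l * fact a)))
        ≈⟨ *-congˡ (*-congˡ (binom*fact*fact≈fact l a)) ⟩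
      binom i j * (fact j * fact (l ℕ.+ a))
        ≈⟨ binom*fact*fact≈fact j (l ℕ.+ a) ⟩
      fact i ∎

  pascalEntry : (ℕ → Carrier) → ℕ → ℕ → Carrier
  pascalEntry p i j with j ≤? i
  ... | yes _ = p (i ∸ j) * binom i j
  ... | no  _ = 0#

  pascalWith≡pascalEntry : ∀ n p (i j : Fin n) → pascalWith n p i j ≡ pascalEntry p (toℕ i) (toℕ j)
  pascalWith≡pascalEntry n p i j with toℕ j ≤? toℕ i
  ... | yes _ = ≡.refl
  ... | no  _ = ≡.refl

  pascalEntry-+ : ∀ p j d → pascalEntry p (j ℕ.+ d) j ≡ p d * binom (j ℕ.+ d) j
  pascalEntry-+ p j d with j ≤? j ℕ.+ d
  ... | yes _      = ≡.cong (λ r → p r * binom (j ℕ.+ d) j) (m+n∸m≡n j d)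
  ... | no  j≰j+d = ⊥-elim (j≰j+d (m≤m+n j d))

  pascalEntry-< : ∀ p {i j} → i < j → pascalEntry p i j ≡ 0#
  pascalEntry-< p {i} {j} i<j with j ≤? i
  ... | yes j≤i = ⊥-elim (<⇒≱ i<j j≤i)
  ... | no  _   = ≡.refl

  -- psiSumPow x y is binomialConvolution (pow x) (pow y).
  binomialConvolution : (ℕ → Carrier) → (ℕ → Carrier) → ℕ → Carrier
  binomialConvolution p q m = ΣFin F (suc m) (λ k → binom m (toℕ k) * (p (toℕ k) * q (m ∸ toℕ k)))

  ΣFin≡∑ℕ : ∀ m {f : Fin m → Carrier} {g : ℕ → Carrier} →
            (∀ k → f k ≡ g (toℕ k)) → ΣFin F m f ≡ ∑ℕ m g
  ΣFin≡∑ℕ zero    f≡g = ≡.refl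
  ΣFin≡∑ℕ (suc m) f≡g = ≡.cong₂ _+_ (f≡g Fin.zero) (ΣFin≡∑ℕ m (λ k → f≡g (Fin.suc k)))

  module _ (p q : ℕ → Carrier) where

    entryProduct : ℕ → ℕ → ℕ → Carrier
    entryProduct i j k = pascalEntry p i k * pascalEntry q k j

    entryProduct-outside : ∀ {i j k} → k < j ⊎ i < k → entryProduct i j k ≈ 0#
    entryProduct-outside (inj₁ k<j) = trans (*-congˡ (reflexive (pascalEntry-< q k<j))) (zeroʳ _)
    entryProduct-outside (inj₂ i<k) = trans (*-congʳ (reflexive (pascalEntry-< p i<k))) (zeroˡ _)

    entryProduct-inside : ∀ j l a → entryProduct (j ℕ.+ (l ℕ.+ a)) j (j ℕ.+ a)
                                    ≈ binom (j ℕ.+ (l ℕ.+ a)) j * (binom (l ℕ.+ a) l * (p l * q a))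
    entryProduct-inside j l a = begin
      pascalEntry p i k * pascalEntry q k j
        ≡⟨ ≡.cong₂ _*_ (≡.trans (≡.cong (λ m → pascalEntry p m k) (x∙yz≈xz∙y j l a))
                                (pascalEntry-+ p k l))
                       (pascalEntry-+ q j a) ⟩
      p l * binom (k ℕ.+ l) k * (q a * binom k j)
        ≡⟨ ≡.cong (λ m → p l * binom m k * (q a * binom k j)) (x∙yz≈xz∙y j l a) ⟨
      p l * binom i k * (q a * binom k j)
        ≈⟨ solve 4 (λ pl u qa v → (pl ⊕ u) ⊕ (qa ⊕ v) ⊜ (u ⊕ v) ⊕ (pl ⊕ qa))
                 refl (p l) (binom i k) (q a) (binom k j) ⟩
      binom i k * binom k j * (p l * q a)
        ≈⟨ *-congʳ (binom-trinomial j l a) ⟩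
      binom i j * binom (l ℕ.+ a) l * (p l * q a)
        ≈⟨ *-assoc _ _ _ ⟩
      binom i j * (binom (l ℕ.+ a) l * (p l * q a)) ∎
      where
      k = j ℕ.+ a
      i = j ℕ.+ (l ℕ.+ a)

    ∑ℕ-entryProduct-+ : ∀ {n} j d → j ℕ.+ d < n →
                        ∑ℕ n (entryProduct (j ℕ.+ d) j) ≈ binomialConvolution p q d * binom (j ℕ.+ d) j
    ∑ℕ-entryProduct-+ {n} j d j+d<n = begin
      ∑ℕ n (entryProduct i j)
        ≈⟨ ∑ℕ-support j d {entryProduct i j} j+d<n (λ _ k<j → entryProduct-outside {i} {j} (inj₁ k<j))
                                                   (λ _ i<k → entryProduct-outside {i} {j} (inj₂ i<k)) ⟩
      ∑ℕ (suc d) (λ t → entryProduct i j (j ℕ.+ t))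
        ≈⟨ ∑ℕ-reverse d (λ t → entryProduct i j (j ℕ.+ t)) ⟩
      ∑ℕ (suc d) (λ l → entryProduct i j (j ℕ.+ (d ∸ l)))
        ≈⟨ ∑ℕ-cong (suc d) (λ _ l<1+d → reversedTerm (≤-pred l<1+d)) ⟩
      ∑ℕ (suc d) (λ l → binom i j * convolutionTerm l)
        ≈⟨ *-distribˡ-∑ℕ (suc d) (binom i j) convolutionTerm ⟨
      binom i j * ∑ℕ (suc d) convolutionTerm
        ≡⟨ ≡.cong (binom i j *_) (ΣFin≡∑ℕ (suc d) {g = convolutionTerm} (λ _ → ≡.refl)) ⟨
      binom i j * binomialConvolution p q d
        ≈⟨ *-comm _ _ ⟩
      binomialConvolution p q d * binom i j ∎
      where
      i = j ℕ.+ d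
      convolutionTerm : ℕ → Carrier
      convolutionTerm l = binom d l * (p l * q (d ∸ l))
      reversedTerm : ∀ {l} → l ≤ d → entryProduct i j (j ℕ.+ (d ∸ l)) ≈ binom i j * convolutionTerm l
      reversedTerm {l} l≤d with m≤n⇒∃[o]m+o≡n l≤d
      ... | a , ≡.refl = begin
        entryProduct i j (j ℕ.+ (l ℕ.+ a ∸ l))
          ≡⟨ ≡.cong (λ r → entryProduct i j (j ℕ.+ r)) (m+n∸m≡n l a) ⟩
        entryProduct i j (j ℕ.+ a)
          ≈⟨ entryProduct-inside j l a ⟩
        binom i j * (binom (l ℕ.+ a) l * (p l * q a))
          ≡⟨ ≡.cong (λ r → binom i j * (binom (l ℕ.+ a) l * (p l * q r))) (m+n∸m≡n l a) ⟨
        binom i j * (binom (l ℕ.+ a) l * (p l * q (l ℕ.+ a ∸ l))) ∎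

    ∑ℕ-entryProduct : ∀ {n i} j → i < n →
                      ∑ℕ n (entryProduct i j) ≈ pascalEntry (binomialConvolution p q) i j
    ∑ℕ-entryProduct {n} {i} j i<n with ≤-<-connex j i
    ... | inj₁ j≤i with m≤n⇒∃[o]m+o≡n j≤i
    ...   | d , ≡.refl = trans (∑ℕ-entryProduct-+ j d i<n) (reflexive (≡.sym (pascalEntry-+ _ j d)))
    ∑ℕ-entryProduct {n} {i} j i<n | inj₂ i<j = begin
      ∑ℕ n (entryProduct i j)
        ≈⟨ ∑ℕ-zero n (λ k _ → entryProduct-outside {i} {j} (outside k)) ⟩
      0#
        ≡⟨ pascalEntry-< _ i<j ⟨
      pascalEntry (binomialConvolution p q) i j ∎
      where
      outside : ∀ k → k < j ⊎ i < k
      outside k = Sum.map₁ (λ k≤i → ≤-<-trans k≤i i<j) (≤-<-connex k i)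

    pascalWith-* : ∀ n →
                   matMul n (pascalWith n p) (pascalWith n q) ≈ᴹ pascalWith n (binomialConvolution p q)
    pascalWith-* n i j = begin
      matMul n (pascalWith n p) (pascalWith n q) i j
        ≡⟨ ΣFin≡∑ℕ n (λ k → ≡.cong₂ _*_ (pascalWith≡pascalEntry n p i k)
                                         (pascalWith≡pascalEntry n q k j)) ⟩
      ∑ℕ n (entryProduct (toℕ i) (toℕ j))
        ≈⟨ ∑ℕ-entryProduct (toℕ j) (toℕ<n i) ⟩
      pascalEntry (binomialConvolution p q) (toℕ i) (toℕ j)
        ≡⟨ pascalWith≡pascalEntry n _ i j ⟨
      pascalWith n (binomialConvolution p q) i j ∎

mainTheorem1 : {c ℓ : Level} (F : Field c ℓ) → CharZero F →
    (ψ : ℕ → Field.Carrier F) → (∀ m → ¬ (Field._≈_ F (ψ (suc m)) (Field.0# F))) →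
    (n : ℕ) → 1 ≤ n → (x y : Field.Carrier F) →
    Psi._≈ᴹ_ F ψ (Psi.matMul F ψ n (Psi.P F ψ n x) (Psi.P F ψ n y)) (Psi.Psum F ψ n x y)
mainTheorem1 F _ ψ ψ≉0 n _ x y = PsiPascal.pascalWith-* F ψ ψ≉0 (pow F x) (pow F y) n
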